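{- Let $G$ be a Helly graph and $k$ a non-negative integer. Then $G$ has $H_1^{k+1}$ as an isometric subgraph if and only if there exist four vertices in $G$ that induce a $C_4$ in $G^\ell$ for every integer $\ell\in[k+1,2k+1]$.
   Context: Graphs are finite, connected, unweighted, undirected and simple; $d$ is the shortest-path distance. A subgraph is isometric if it is induced and distance-preserving; "has $H$ as an isometric subgraph" means has an isometric subgraph isomorphic to $H$. A graph is Helly if every family of pairwise intersecting disks $D(v,r)=\{u:d(u,v)\le r\}$ has a common vertex. $G^\ell$ is the graph on $V(G)$ with $uv$ an edge iff $0<d(u,v)\le \ell$; $C_4$ is the cycle on four vertices. King-grid: the graph on $\mathbb{Z}^2$ in which distinct $(x,y),(x',y')$ are adjacent iff $\max(|x-x'|,|y-y'|)=1$; for $u=(x,y)$ let $s(u)=x+y$, $t(u)=x-y$. $H_1^{m}$ is the subgraph of the King-grid induced by $\{u: 0\le s(u)\le 2m,\ 0\le t(u)\le 2m\}$. -}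

module Defs where

open import Data.Nat as ℕ using (ℕ; zero; suc; _⊔_; _%_)
open import Data.Integer as ℤ using (ℤ; +_; ∣_∣)
open import Data.Fin using (Fin; toℕ)
open import Data.Product using (Σ; ∃; _×_; _,_; proj₁)
open import Data.Sum using (_⊎_)
open import Relation.Nullary using (¬_)
open import Relation.Binary.PropositionalEquality using (_≡_; _≢_)
open import Relation.Binary using (Decidable)
open import Function.Bundles using (_⇔_)
open import Function.Definitions using (Injective)

data Walk {V : Set} (E : V → V → Set) : V → V → Set where
  []  : ∀ {u} → Walk E u u
  _∷_ : ∀ {u w v} → E u w → Walk E w v → Walk E u v

len : ∀ {V : Set} {E : V → V → Set} {u v : V} → Walk E u v → ℕ
len []      = 0
len (_ ∷ p) = suc (len p)

IsDist : {V : Set} (E : V → V → Set) → V → V → ℕ → Set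
IsDist E u v r = Σ (Walk E u v) (λ p → len p ≡ r) × (∀ (p : Walk E u v) → r ℕ.≤ len p)

record Graph : Set₁ where
  field
    n         : ℕ
    Adj       : Fin n → Fin n → Set
    adj?      : Decidable Adj
    sym       : ∀ {u v} → Adj u v → Adj v u
    irrefl    : ∀ {u} → ¬ Adj u u
    connected : ∀ u v → Walk Adj u v

  V : Set
  V = Fin n

  Dist : V → V → ℕ → Set
  Dist = IsDist Adj

  InDisk : V → V → ℕ → Set
  InDisk u v r = ∃ λ d → Dist u v d × d ℕ.≤ r

open Graph public

Helly : Graph → Set
Helly G = ∀ (m : ℕ) (c : Fin m → V G) (r : Fin m → ℕ) →
  (∀ i j → ∃ λ u → InDisk G u (c i) (r i) × InDisk G u (c j) (r j)) →
  ∃ λ u → ∀ i → InDisk G u (c i) (r i)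

PowAdj : (G : Graph) → ℕ → V G → V G → Set
PowAdj G ℓ u v = ∃ λ d → Dist G u v d × 0 ℕ.< d × d ℕ.≤ ℓ

C4Adj : Fin 4 → Fin 4 → Set
C4Adj i j = toℕ j ≡ (suc (toℕ i)) % 4 ⊎ toℕ i ≡ (suc (toℕ j)) % 4

-- The vertices w 0, …, w 3 (assumed distinct) induce a C4 in the graph
-- with adjacency E: the induced subgraph is isomorphic to C4, i.e. some
-- bijective relabelling σ of Fin 4 turns it exactly into the cycle.
InducesC4 : {V : Set} (E : V → V → Set) → (Fin 4 → V) → Set
InducesC4 E w = ∃ λ (σ : Fin 4 → Fin 4) → Injective _≡_ _≡_ σ ×
  (∀ i j → E (w (σ i)) (w (σ j)) ⇔ C4Adj i j)

s t : ℤ × ℤ → ℤ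
s (x , y) = x ℤ.+ y
t (x , y) = x ℤ.- y

KingAdj : ℤ × ℤ → ℤ × ℤ → Set
KingAdj (x , y) (x' , y') = (x , y) ≢ (x' , y') × (∣ x ℤ.- x' ∣ ⊔ ∣ y ℤ.- y' ∣ ≡ 1)

H1V : ℕ → Set
H1V m = Σ (ℤ × ℤ) λ u →
  (+ 0 ℤ.≤ s u) × (s u ℤ.≤ + (2 ℕ.* m)) × (+ 0 ℤ.≤ t u) × (t u ℤ.≤ + (2 ℕ.* m))

H1Adj : (m : ℕ) → H1V m → H1V m → Set
H1Adj m a b = KingAdj (proj₁ a) (proj₁ b)

HasIsometricH1 : Graph → ℕ → Set
HasIsometricH1 G m = ∃ λ (f : H1V m → V G) →
  (∀ a b → f a ≡ f b → proj₁ a ≡ proj₁ b) ×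
  (∀ a b → H1Adj m a b ⇔ Adj G (f a) (f b)) ×
  (∀ a b r → IsDist (H1Adj m) a b r → Dist G (f a) (f b) r)

HasC4InPowers : Graph → ℕ → Set
HasC4InPowers G k = ∃ λ (w : Fin 4 → V G) → Injective _≡_ _≡_ w ×
  (∀ ℓ → suc k ℕ.≤ ℓ → ℓ ℕ.≤ suc (2 ℕ.* k) → InducesC4 (PowAdj G ℓ) w)

-- H₁^m is isometric to the diamond {(a , b) ∈ ℕ² : |a − b| ≤ m ≤ a + b ≤ 3m} with the Chebyshev
-- (King-grid) metric. Its corners (0 , m), (m , 0), (2m , m), (m , 2m) form a 4-cycle with sides m
-- and diagonals 2m, so the images of the corners induce C₄ in Gˡ exactly for m ≤ ℓ < 2m.
-- Conversely, if four vertices induce C₄ both in G^m and in G^(2m−1), the sides have length at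
-- most m and, G^(2m−1) being triangle-free on them, the diagonals have length 2m; this forces all
-- corner distances. In a Helly graph the corners then extend point by point to an isometric copy
-- of the diamond: the disks around the vertices placed so far, with the radii prescribed by the
-- Chebyshev metric, pairwise intersect. A common vertex is at exactly the prescribed distances:
-- as the diamond lies metrically between opposite corners, its distances to two adjacent corners
-- are forced to be the coordinates of the new point, and these bound all other distances below.
module Submission where

open import Defs hiding (sym)
open import Data.Nat as ℕ
  using (ℕ; zero; suc; _+_; _∸_; _*_; _≤_; _<_; _≤?_; z≤n; s≤s; _⊔_; _⊓_; ∣_-_∣)
open import Data.Nat.Properties
open import Data.Nat.Induction using (<-rec)
open import Data.Integer as ℤ using (ℤ; +_; -[1+_]; _⊖_; +≤+)
import Data.Integer.Properties as ℤ
open import Data.Integer.Tactic.RingSolver using (solve-∀)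
open import Data.Fin using (Fin; zero; suc; toℕ; punchOut)
import Data.Fin.Properties as Fin
open import Data.Product using (Σ; ∃; _×_; _,_; proj₁; proj₂; map)
open import Data.Product.Function.NonDependent.Propositional using (_×-⇔_)
open import Data.Sum using (_⊎_; inj₁; inj₂)
open import Data.List using (List; []; _∷_; length; lookup; tabulate; upTo; cartesianProduct)
open import Data.List.Relation.Unary.Any using (here; there; index)
open import Data.List.Relation.Unary.Any.Properties using (lookup-index)
open import Data.List.Membership.Propositional using (_∈_)
open import Data.List.Membership.Propositional.Properties
  using (∈-lookup; ∈-tabulate⁺; ∈-tabulate⁻; ∈-upTo⁺; ∈-cartesianProduct⁺)
open import Relation.Nullary using (¬_; Dec; yes; no; _×-dec_; _→-dec_; _⊎-dec_; ¬?; contradiction)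
open import Relation.Nullary.Decidable using (toWitness)
open import Relation.Unary using (Decidable)
open import Relation.Binary.PropositionalEquality
open import Function.Base using (id; _∘_)
open import Function.Bundles using (_⇔_; mk⇔; Equivalence)
open import Function.Definitions using (Injective)
import Function.Properties.Equivalence as ⇔

least-witness : {P : ℕ → Set} → Decidable P → ∀ n → P n →
  ∃ λ r → P r × (∀ {r′} → P r′ → r ≤ r′)
least-witness {P} P? = <-rec _ search
  where
  search : ∀ n → (∀ {r} → r < n → P r → ∃ λ r → P r × (∀ {r′} → P r′ → r ≤ r′)) →
    P n → ∃ λ r → P r × (∀ {r′} → P r′ → r ≤ r′)
  search n rec pn with anyUpTo? P? n
  ... | yes (r , r<n , pr) = rec r<n pr
  ... | no none = n , pn , λ {r′} pr′ → ≮⇒≥ λ r′<n → none (r′ , r′<n , pr′)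

2*m≡m+m : ∀ m → 2 * m ≡ m + m
2*m≡m+m m = cong (m ℕ.+_) (+-identityʳ m)

∣m-n∣≤o : ∀ {m n o} → m ≤ o + n → n ≤ o + m → ∣ m - n ∣ ≤ o
∣m-n∣≤o {m} {n} {o} m≤ n≤ with ∣m-n∣≡[m∸n]∨[n∸m] m n
... | inj₁ eq = subst (_≤ o) (sym eq) (m≤n+o⇒m∸n≤o m n (subst (m ≤_) (+-comm o n) m≤))
... | inj₂ eq = subst (_≤ o) (sym eq) (m≤n+o⇒m∸n≤o n m (subst (n ≤_) (+-comm o m) n≤))

-- Walks and distances

module _ {V : Set} {E : V → V → Set} where

  _++ʷ_ : ∀ {u v w} → Walk E u v → Walk E v w → Walk E u w
  []      ++ʷ q = q
  (e ∷ p) ++ʷ q = e ∷ (p ++ʷ q)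

  len-++ʷ : ∀ {u v w} (p : Walk E u v) (q : Walk E v w) → len (p ++ʷ q) ≡ len p + len q
  len-++ʷ []      q = refl
  len-++ʷ (e ∷ p) q = cong suc (len-++ʷ p q)

  module _ (E-sym : ∀ {u v} → E u v → E v u) where

    reverseʷ : ∀ {u v} → Walk E u v → Walk E v u
    reverseʷ []      = []
    reverseʷ (e ∷ p) = reverseʷ p ++ʷ (E-sym e ∷ [])

    len-reverseʷ : ∀ {u v} (p : Walk E u v) → len (reverseʷ p) ≡ len p
    len-reverseʷ []      = refl
    len-reverseʷ (e ∷ p) = begin
      len (reverseʷ p ++ʷ (E-sym e ∷ [])) ≡⟨ len-++ʷ (reverseʷ p) _ ⟩
      len (reverseʷ p) + 1                ≡⟨ +-comm (len (reverseʷ p)) 1 ⟩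
      suc (len (reverseʷ p))              ≡⟨ cong suc (len-reverseʷ p) ⟩
      suc (len p)                         ∎
      where open ≡-Reasoning

  splitAtʷ : ∀ {u v} (r : ℕ) (p : Walk E u v) → ∃ λ w →
    Σ (Walk E u w) λ p₁ → Σ (Walk E w v) λ p₂ → len p₁ ≤ r × len p₂ ≤ len p ∸ r
  splitAtʷ zero    p       = _ , [] , p , z≤n , ≤-refl
  splitAtʷ (suc r) []      = _ , [] , [] , z≤n , z≤n
  splitAtʷ (suc r) (e ∷ p) with w , p₁ , p₂ , l₁ , l₂ ← splitAtʷ r p =
    w , e ∷ p₁ , p₂ , s≤s l₁ , l₂

  IsDist-unique : ∀ {u v r r′} → IsDist E u v r → IsDist E u v r′ → r ≡ r′
  IsDist-unique ((p , refl) , p-min) ((q , refl) , q-min) = ≤-antisym (p-min q) (q-min p)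

module Metric (G : Graph) where

  WalkWithin : ℕ → V G → V G → Set
  WalkWithin r u v = Σ (Walk (Adj G) u v) λ p → len p ≤ r

  walkWithin? : ∀ r u v → Dec (WalkWithin r u v)
  walkWithin? r u v with u Fin.≟ v
  ... | yes refl = yes ([] , z≤n)
  walkWithin? zero    u v | no u≢v = no λ { ([] , _) → u≢v refl ; (_ ∷ _ , ()) }
  walkWithin? (suc r) u v | no u≢v with Fin.any? (λ w → adj? G u w ×-dec walkWithin? r w v)
  ... | yes (w , e , p , lp) = yes (e ∷ p , s≤s lp)
  ... | no none = no λ { ([] , _) → u≢v refl ; (e ∷ p , s≤s lp) → none (_ , e , p , lp) }

  dist-exists : ∀ u v → ∃ (Dist G u v)
  dist-exists u v with least-witness (λ r → walkWithin? r u v) _ (connected G u v , ≤-refl)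
  ... | r , (p , lp) , r-min = r , (p , ≤-antisym lp (r-min (p , ≤-refl))) , λ q → r-min (q , ≤-refl)

  opaque
    dist : V G → V G → ℕ
    dist u v = proj₁ (dist-exists u v)

    dist-isDist : ∀ u v → Dist G u v (dist u v)
    dist-isDist u v = proj₂ (dist-exists u v)

  Dist⇒≡dist : ∀ {u v r} → Dist G u v r → r ≡ dist u v
  Dist⇒≡dist D = IsDist-unique D (dist-isDist _ _)

  dist≤len : ∀ {u v} (p : Walk (Adj G) u v) → dist u v ≤ len p
  dist≤len {u} {v} = proj₂ (dist-isDist u v)

  geodesic : ∀ u v → Σ (Walk (Adj G) u v) λ p → len p ≡ dist u v
  geodesic u v = proj₁ (dist-isDist u v)

  dist-triangle : ∀ u v w → dist u w ≤ dist u v + dist v w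
  dist-triangle u v w with p , lp ← geodesic u v | q , lq ← geodesic v w =
    subst (dist u w ≤_) (trans (len-++ʷ p q) (cong₂ _+_ lp lq)) (dist≤len (p ++ʷ q))

  dist-sym : ∀ u v → dist u v ≡ dist v u
  dist-sym u v = ≤-antisym (reversed v u) (reversed u v)
    where
    reversed : ∀ a b → dist b a ≤ dist a b
    reversed a b with p , lp ← geodesic a b = subst (dist b a ≤_)
      (trans (len-reverseʷ (Graph.sym G) p) lp) (dist≤len (reverseʷ (Graph.sym G) p))

  dist-refl : ∀ u → dist u u ≡ 0
  dist-refl u = n≤0⇒n≡0 (dist≤len {u} [])

  dist≡0⇒≡ : ∀ {u v} → dist u v ≡ 0 → u ≡ v
  dist≡0⇒≡ {u} {v} d≡0 with geodesic u v
  ... | []    , _    = refl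
  ... | _ ∷ _ , lp≡d with () ← trans lp≡d d≡0

  Adj⇒dist≡1 : ∀ {u v} → Adj G u v → dist u v ≡ 1
  Adj⇒dist≡1 {u} e = ≤-antisym (dist≤len (e ∷ []))
    (n≢0⇒n>0 λ d≡0 → irrefl G (subst (Adj G u) (sym (dist≡0⇒≡ d≡0)) e))

  dist≡1⇒Adj : ∀ {u v} → dist u v ≡ 1 → Adj G u v
  dist≡1⇒Adj {u} {v} d≡1 with geodesic u v
  ... | e ∷ [] , _ = e
  ... | [] , lp≡d with () ← trans lp≡d d≡1
  ... | _ ∷ (_ ∷ _) , lp≡d with () ← trans lp≡d d≡1

  dist-split : ∀ u v r₁ r₂ → dist u v ≤ r₁ + r₂ → ∃ λ x → dist x u ≤ r₁ × dist x v ≤ r₂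
  dist-split u v r₁ r₂ d≤ with geodesic u v
  ... | p , lp with x , p₁ , p₂ , l₁ , l₂ ← splitAtʷ r₁ p =
    x , ≤-trans (≤-reflexive (dist-sym x u)) (≤-trans (dist≤len p₁) l₁)
      , ≤-trans (dist≤len p₂) (≤-trans l₂ (m≤n+o⇒m∸n≤o (len p) r₁ (subst (_≤ r₁ + r₂) (sym lp) d≤)))

  InDisk⇔ : ∀ {x c r} → InDisk G x c r ⇔ dist x c ≤ r
  InDisk⇔ = mk⇔ (λ (d , D , d≤r) → subst (_≤ _) (Dist⇒≡dist D) d≤r)
                (λ d≤r → _ , dist-isDist _ _ , d≤r)

  PowAdj⇔ : ∀ ℓ u v → PowAdj G ℓ u v ⇔ (0 < dist u v × dist u v ≤ ℓ)
  PowAdj⇔ ℓ u v = mk⇔ (λ (d , D , bounds) → subst (λ d → 0 < d × d ≤ ℓ) (Dist⇒≡dist D) bounds)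
                      (λ bounds → dist u v , dist-isDist u v , bounds)

  disks-intersect : ∀ u v r₁ r₂ → dist u v ≤ r₁ + r₂ →
    ∃ λ x → InDisk G x u r₁ × InDisk G x v r₂
  disks-intersect u v r₁ r₂ d≤ with x , x₁ , x₂ ← dist-split u v r₁ r₂ d≤ =
    x , Equivalence.from InDisk⇔ x₁ , Equivalence.from InDisk⇔ x₂

  dist-reverse-triangle : ∀ x v w → ∣ dist x w - dist v w ∣ ≤ dist x v
  dist-reverse-triangle x v w = ∣m-n∣≤o (dist-triangle x v w)
    (subst (λ d → dist v w ≤ d + dist x w) (dist-sym v x) (dist-triangle v x w))

  dist-squeeze : ∀ {u w x s t} → dist u w ≡ s + t → dist x u ≤ s → dist x w ≤ t → dist x u ≡ s
  dist-squeeze {u} {w} {x} {s} {t} uw≡ xu≤ xw≤ = ≤-antisym xu≤ (+-cancelʳ-≤ t s (dist x u) (begin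
    s + t               ≡⟨ sym uw≡ ⟩
    dist u w            ≤⟨ dist-triangle u x w ⟩
    dist u x + dist x w ≤⟨ +-mono-≤ (≤-reflexive (dist-sym u x)) xw≤ ⟩
    dist x u + t        ∎))
    where open ≤-Reasoning

-- The Chebyshev plane and the diamond

Point : Set
Point = ℕ × ℕ

chebyshev : Point → Point → ℕ
chebyshev (a , b) (a′ , b′) = ∣ a - a′ ∣ ⊔ ∣ b - b′ ∣

chebyshev-sym : ∀ p q → chebyshev p q ≡ chebyshev q p
chebyshev-sym (a , b) (a′ , b′) = cong₂ _⊔_ (∣-∣-comm a a′) (∣-∣-comm b b′)

chebyshev-refl : ∀ p → chebyshev p p ≡ 0
chebyshev-refl (a , b) = cong₂ _⊔_ (∣n-n∣≡0 a) (∣n-n∣≡0 b)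

chebyshev≡0⇒≡ : ∀ {p q} → chebyshev p q ≡ 0 → p ≡ q
chebyshev≡0⇒≡ {a , b} {a′ , b′} eq = cong₂ _,_
  (∣m-n∣≡0⇒m≡n (n≤0⇒n≡0 (subst (_ ≤_) eq (m≤m⊔n ∣ a - a′ ∣ ∣ b - b′ ∣))))
  (∣m-n∣≡0⇒m≡n (n≤0⇒n≡0 (subst (_ ≤_) eq (m≤n⊔m ∣ a - a′ ∣ ∣ b - b′ ∣))))

chebyshev-triangle : ∀ p q r → chebyshev p r ≤ chebyshev p q + chebyshev q r
chebyshev-triangle (a , b) (a′ , b′) (a″ , b″) = ⊔-lub
  (≤-trans (∣-∣-triangle a a′ a″)
    (+-mono-≤ (m≤m⊔n ∣ a - a′ ∣ ∣ b - b′ ∣) (m≤m⊔n ∣ a′ - a″ ∣ ∣ b′ - b″ ∣)))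
  (≤-trans (∣-∣-triangle b b′ b″)
    (+-mono-≤ (m≤n⊔m ∣ a - a′ ∣ ∣ b - b′ ∣) (m≤n⊔m ∣ a′ - a″ ∣ ∣ b′ - b″ ∣)))

swap : Point → Point
swap (a , b) = b , a

chebyshev-swap : ∀ p q → chebyshev (swap p) (swap q) ≡ chebyshev p q
chebyshev-swap (a , b) (a′ , b′) = ⊔-comm ∣ b - b′ ∣ ∣ a - a′ ∣

scale : ℕ → Point → Point
scale m (a , b) = a * m , b * m

chebyshev-scale : ∀ m p q → chebyshev (scale m p) (scale m q) ≡ chebyshev p q * m
chebyshev-scale m (a , b) (a′ , b′) = begin
  ∣ a * m - a′ * m ∣ ⊔ ∣ b * m - b′ * m ∣
    ≡⟨ cong₂ _⊔_ (*-distribʳ-∣-∣ m a a′) (*-distribʳ-∣-∣ m b b′) ⟨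
  ∣ a - a′ ∣ * m ⊔ ∣ b - b′ ∣ * m
    ≡⟨ *-distribʳ-⊔ m ∣ a - a′ ∣ ∣ b - b′ ∣ ⟨
  (∣ a - a′ ∣ ⊔ ∣ b - b′ ∣) * m ∎
  where open ≡-Reasoning

toward : ℕ → ℕ → ℕ
toward zero    zero     = zero
toward zero    (suc _)  = 1
toward (suc a) zero     = a
toward (suc a) (suc a′) = suc (toward a a′)

∣toward-target∣ : ∀ a a′ → ∣ toward a a′ - a′ ∣ ≡ ∣ a - a′ ∣ ∸ 1
∣toward-target∣ zero    zero     = refl
∣toward-target∣ zero    (suc a′) = refl
∣toward-target∣ (suc a) zero     = ∣-∣-identityʳ a
∣toward-target∣ (suc a) (suc a′) = ∣toward-target∣ a a′

∣source-toward∣ : ∀ a a′ → ∣ a - toward a a′ ∣ ≡ 1 ⊓ ∣ a - a′ ∣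
∣source-toward∣ zero    zero     = refl
∣source-toward∣ zero    (suc a′) = refl
∣source-toward∣ (suc a) zero     =
  trans (∣-∣-comm (suc a) a) (trans (cong ∣ a -_∣ (+-comm 1 a)) (∣m-m+n∣≡n a 1))
∣source-toward∣ (suc a) (suc a′) = ∣source-toward∣ a a′

data Toward (a a′ : ℕ) : ℕ → Set where
  up   : a < a′ → Toward a a′ (suc a)
  stay : a ≡ a′ → Toward a a′ a
  down : ∀ {t} → suc t ≡ a → a′ ≤ t → Toward a a′ t

toward-view : ∀ a a′ → Toward a a′ (toward a a′)
toward-view zero    zero     = stay refl
toward-view zero    (suc a′) = up (s≤s z≤n)
toward-view (suc a) zero     = down refl z≤n
toward-view (suc a) (suc a′) with toward a a′ | toward-view a a′
... | _ | up a<a′       = up (s≤s a<a′)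
... | _ | stay refl     = stay refl
... | _ | down refl a′≤ = down refl (s≤s a′≤)

toward-pres-≤+ : ∀ a a′ b b′ c → b ≤ a + c → b′ ≤ a′ + c → toward b b′ ≤ toward a a′ + c
toward-pres-≤+ a a′ b b′ c h h′ with toward b b′ | toward-view b b′ | toward a a′ | toward-view a a′
... | _ | up x        | _ | up y        = s≤s h
... | _ | up x        | _ | stay refl   = ≤-trans x h′
... | _ | up x        | _ | down refl y = ≤-trans x (≤-trans h′ (+-monoˡ-≤ c y))
... | _ | stay refl   | _ | up y        = ≤-trans h (+-monoˡ-≤ c (n≤1+n a))
... | _ | stay refl   | _ | stay refl   = h
... | _ | stay refl   | _ | down refl y = ≤-trans h′ (+-monoˡ-≤ c y)
... | _ | down refl x | _ | up y        = ≤-trans (n≤1+n _) (≤-trans h (+-monoˡ-≤ c (n≤1+n a)))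
... | _ | down refl x | _ | stay refl   = ≤-trans (n≤1+n _) h
... | _ | down refl x | _ | down refl y = ≤-pred h

toward-pres-≤sum : ∀ a a′ b b′ c → c ≤ a + b → c ≤ a′ + b′ → c ≤ toward a a′ + toward b b′
toward-pres-≤sum a a′ b b′ c h h′ with toward a a′ | toward-view a a′ | toward b b′ | toward-view b b′
... | _ | up x            | _ | up y            = ≤-trans h (+-mono-≤ (n≤1+n a) (n≤1+n b))
... | _ | up x            | _ | stay refl       = ≤-trans h (+-monoˡ-≤ b (n≤1+n a))
... | _ | up x            | _ | down {t} refl y = subst (c ≤_) (+-suc a t) h
... | _ | stay refl       | _ | up y            = ≤-trans h (+-monoʳ-≤ a (n≤1+n b))
... | _ | stay refl       | _ | stay refl       = h
... | _ | stay refl       | _ | down refl y     = ≤-trans h′ (+-monoʳ-≤ a y)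
... | _ | down {t} refl x | _ | up y            = subst (c ≤_) (sym (+-suc t b)) h
... | _ | down refl x     | _ | stay refl       = ≤-trans h′ (+-monoˡ-≤ b x)
... | _ | down refl x     | _ | down refl y     = ≤-trans h′ (+-mono-≤ x y)

toward-pres-sum≤ : ∀ a a′ b b′ c → a + b ≤ c → a′ + b′ ≤ c → toward a a′ + toward b b′ ≤ c
toward-pres-sum≤ a a′ b b′ c h h′ with toward a a′ | toward-view a a′ | toward b b′ | toward-view b b′
... | _ | up x            | _ | up y            = ≤-trans (+-mono-≤ x y) h′
... | _ | up x            | _ | stay refl       = ≤-trans (+-monoˡ-≤ b x) h′
... | _ | up x            | _ | down {t} refl y = subst (_≤ c) (+-suc a t) h
... | _ | stay refl       | _ | up y            = ≤-trans (+-monoʳ-≤ a y) h′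
... | _ | stay refl       | _ | stay refl       = h
... | _ | stay refl       | _ | down refl y     = ≤-trans (+-monoʳ-≤ a (n≤1+n _)) h
... | _ | down {t} refl x | _ | up y            = subst (_≤ c) (sym (+-suc t b)) h
... | _ | down refl x     | _ | stay refl       = ≤-trans (+-monoˡ-≤ b (n≤1+n _)) h
... | _ | down refl x     | _ | down refl y     = ≤-trans (+-mono-≤ (n≤1+n _) (n≤1+n _)) h

stepTo : Point → Point → Point
stepTo (a , b) (a′ , b′) = toward a a′ , toward b b′

chebyshev-stepTo-source : ∀ p q → chebyshev p (stepTo p q) ≡ 1 ⊓ chebyshev p q
chebyshev-stepTo-source (a , b) (a′ , b′) = trans
  (cong₂ _⊔_ (∣source-toward∣ a a′) (∣source-toward∣ b b′))
  (sym (⊓-distribˡ-⊔ 1 ∣ a - a′ ∣ ∣ b - b′ ∣))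

chebyshev-stepTo-target : ∀ p q → chebyshev (stepTo p q) q ≡ chebyshev p q ∸ 1
chebyshev-stepTo-target (a , b) (a′ , b′) = trans
  (cong₂ _⊔_ (∣toward-target∣ a a′) (∣toward-target∣ b b′))
  (sym (∸-distribʳ-⊔ 1 ∣ a - a′ ∣ ∣ b - b′ ∣))

-- The vertex set of H₁^m in the coordinates (a , b) = (x , m − y), see H1.coords.
Diamond : ℕ → Point → Set
Diamond m (a , b) = b ≤ a + m × a ≤ b + m × m ≤ a + b × a + b ≤ m + m + m

diamond? : ∀ m p → Dec (Diamond m p)
diamond? m (a , b) = b ≤? a + m ×-dec a ≤? b + m ×-dec m ≤? a + b ×-dec a + b ≤? m + m + m

Diamond-swap : ∀ {m p} → Diamond m p → Diamond m (swap p)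
Diamond-swap {m} {a , b} (b≤ , a≤ , m≤ , ≤3m) =
  a≤ , b≤ , subst (m ≤_) (+-comm a b) m≤ , subst (_≤ m + m + m) (+-comm a b) ≤3m

Diamond-stepTo : ∀ {m p q} → Diamond m p → Diamond m q → Diamond m (stepTo p q)
Diamond-stepTo {m} {a , b} {a′ , b′} (b≤ , a≤ , m≤ , ≤3m) (b′≤ , a′≤ , m≤′ , ≤3m′) =
  toward-pres-≤+ a a′ b b′ m b≤ b′≤ , toward-pres-≤+ b b′ a a′ m a≤ a′≤ ,
  toward-pres-≤sum a a′ b b′ m m≤ m≤′ , toward-pres-sum≤ a a′ b b′ _ ≤3m ≤3m′

Diamond-bound : ∀ {m a b} → Diamond m (a , b) → a ≤ m + m
Diamond-bound {m} {a} {b} (_ , a≤ , _ , ≤3m) with a ≤? m + m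
... | yes a≤2m = a≤2m
... | no  a≰2m = contradiction (begin
  a + a             ≤⟨ +-monoʳ-≤ a a≤ ⟩
  a + (b + m)       ≡⟨ +-assoc a b m ⟨
  a + b + m         ≤⟨ +-monoˡ-≤ m ≤3m ⟩
  m + m + m + m     ≡⟨ +-assoc (m + m) m m ⟩
  (m + m) + (m + m) ∎) (<⇒≱ (+-mono-< (≰⇒> a≰2m) (≰⇒> a≰2m)))
  where open ≤-Reasoning

unitCorner : Fin 4 → Point
unitCorner zero                   = 0 , 1
unitCorner (suc zero)             = 1 , 0
unitCorner (suc (suc zero))       = 2 , 1
unitCorner (suc (suc (suc zero))) = 1 , 2

corner : ℕ → Fin 4 → Point
corner m zero                   = 0 , m
corner m (suc zero)             = m , 0
corner m (suc (suc zero))       = m + m , m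
corner m (suc (suc (suc zero))) = m , m + m

corner≡scale : ∀ m i → corner m i ≡ scale m (unitCorner i)
corner≡scale m zero                   = cong (0 ,_) (sym (*-identityˡ m))
corner≡scale m (suc zero)             = cong (_, 0) (sym (*-identityˡ m))
corner≡scale m (suc (suc zero))       = cong₂ _,_ (sym (2*m≡m+m m)) (sym (*-identityˡ m))
corner≡scale m (suc (suc (suc zero))) = cong₂ _,_ (sym (*-identityˡ m)) (sym (2*m≡m+m m))

-- The unit corners form an isometric 4-cycle, so this is the distance in C₄ (c4-classification).
c4Dist : Fin 4 → Fin 4 → ℕ
c4Dist i j = chebyshev (unitCorner i) (unitCorner j)

chebyshev-corner : ∀ m i j → chebyshev (corner m i) (corner m j) ≡ c4Dist i j * m
chebyshev-corner m i j = trans (cong₂ chebyshev (corner≡scale m i) (corner≡scale m j))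
  (chebyshev-scale m (unitCorner i) (unitCorner j))

Diamond-corner : ∀ m i → Diamond m (corner m i)
Diamond-corner m zero                   = ≤-refl , z≤n , ≤-refl , m≤n+m m (m + m)
Diamond-corner m (suc zero)             = Diamond-swap {m} {corner m zero} (Diamond-corner m zero)
Diamond-corner m (suc (suc zero))       = m≤n+m m (m + m) , ≤-refl , m≤n+m m (m + m) , ≤-refl
Diamond-corner m (suc (suc (suc zero))) =
  Diamond-swap {m} {corner m (suc (suc zero))} (Diamond-corner m (suc (suc zero)))

chebyshev-corner₀ : ∀ {m a b} → Diamond m (a , b) → chebyshev (a , b) (corner m zero) ≡ a
chebyshev-corner₀ {m} {a} {b} (b≤ , _ , m≤ , _) =
  trans (cong (_⊔ ∣ b - m ∣) (∣-∣-identityʳ a)) (m≥n⇒m⊔n≡m (∣m-n∣≤o b≤ m≤))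

chebyshev-corner₁ : ∀ {m a b} → Diamond m (a , b) → chebyshev (a , b) (corner m (suc zero)) ≡ b
chebyshev-corner₁ {m} {a} {b} d =
  trans (chebyshev-swap (b , a) (corner m zero)) (chebyshev-corner₀ (Diamond-swap {m} {a , b} d))

chebyshev-corner₂ : ∀ {m a b} → Diamond m (a , b) →
  chebyshev (a , b) (corner m (suc (suc zero))) ≡ m + m ∸ a
chebyshev-corner₂ {m} {a} {b} d@(_ , a≤ , _ , ≤3m) =
  trans (cong (_⊔ ∣ b - m ∣) (m≤n⇒∣m-n∣≡n∸m (Diamond-bound d))) (m≥n⇒m⊔n≡m (∣m-n∣≤o b≤ m≤))
  where
  a+[2m-a] : a + (m + m ∸ a) ≡ m + m
  a+[2m-a] = m+[n∸m]≡n (Diamond-bound d)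
  b≤ : b ≤ (m + m ∸ a) + m
  b≤ = +-cancelˡ-≤ a b _ (subst (a + b ≤_) (trans (cong (_+ m) (sym a+[2m-a])) (+-assoc a _ m)) ≤3m)
  m≤ : m ≤ (m + m ∸ a) + b
  m≤ = +-cancelˡ-≤ a m _ (begin
    a + m                 ≤⟨ +-monoˡ-≤ m a≤ ⟩
    b + m + m             ≡⟨ +-comm (b + m) m ⟩
    m + (b + m)           ≡⟨ cong (m ℕ.+_) (+-comm b m) ⟩
    m + (m + b)           ≡⟨ +-assoc m m b ⟨
    m + m + b             ≡⟨ cong (_+ b) a+[2m-a] ⟨
    a + (m + m ∸ a) + b   ≡⟨ +-assoc a _ b ⟩
    a + ((m + m ∸ a) + b) ∎)
    where open ≤-Reasoning

between-corners₀₂ : ∀ {m p} → Diamond m p →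
  chebyshev p (corner m zero) + chebyshev p (corner m (suc (suc zero)))
  ≡ chebyshev (corner m zero) (corner m (suc (suc zero)))
between-corners₀₂ {m} {a , b} d = begin
  chebyshev (a , b) (corner m zero) + chebyshev (a , b) (corner m (suc (suc zero)))
    ≡⟨ cong₂ _+_ (chebyshev-corner₀ d) (chebyshev-corner₂ d) ⟩
  a + (m + m ∸ a) ≡⟨ m+[n∸m]≡n (Diamond-bound d) ⟩
  m + m           ≡⟨ ⊔-identityʳ (m + m) ⟨
  (m + m) ⊔ 0     ≡⟨ cong ((m + m) ⊔_) (∣n-n∣≡0 m) ⟨
  chebyshev (corner m zero) (corner m (suc (suc zero))) ∎
  where open ≡-Reasoning

between-corners₁₃ : ∀ {m p} → Diamond m p →
  chebyshev p (corner m (suc zero)) + chebyshev p (corner m (suc (suc (suc zero))))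
  ≡ chebyshev (corner m (suc zero)) (corner m (suc (suc (suc zero))))
between-corners₁₃ {m} {a , b} d = begin
  chebyshev (a , b) (corner m (suc zero)) + chebyshev (a , b) (corner m (suc (suc (suc zero))))
    ≡⟨ cong₂ _+_ (chebyshev-swap (b , a) (corner m zero)) (chebyshev-swap (b , a) (corner m (suc (suc zero)))) ⟩
  chebyshev (b , a) (corner m zero) + chebyshev (b , a) (corner m (suc (suc zero)))
    ≡⟨ between-corners₀₂ {p = b , a} (Diamond-swap {m} {a , b} d) ⟩
  chebyshev (corner m zero) (corner m (suc (suc zero)))
    ≡⟨ chebyshev-swap (corner m zero) (corner m (suc (suc zero))) ⟨
  chebyshev (corner m (suc zero)) (corner m (suc (suc (suc zero)))) ∎
  where open ≡-Reasoning

chebyshev-via-corners : ∀ {m p q} → Diamond m p → Diamond m q →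
  chebyshev p q ≡ ∣ chebyshev p (corner m zero) - chebyshev q (corner m zero) ∣
                ⊔ ∣ chebyshev p (corner m (suc zero)) - chebyshev q (corner m (suc zero)) ∣
chebyshev-via-corners {p = a , b} {a′ , b′} d d′ =
  sym (cong₂ _⊔_ (cong₂ ∣_-_∣ (chebyshev-corner₀ d) (chebyshev-corner₀ d′))
                 (cong₂ ∣_-_∣ (chebyshev-corner₁ d) (chebyshev-corner₁ d′)))

-- H₁^m as the diamond

0≤⊖⇔ : ∀ {p q} → + 0 ℤ.≤ p ⊖ q ⇔ q ≤ p
0≤⊖⇔ {p} {q} = mk⇔ to from
  where
  from : q ≤ p → + 0 ℤ.≤ p ⊖ q
  from q≤p = subst (ℤ._≤ p ⊖ q) (ℤ.n⊖n≡0 q) (ℤ.⊖-monoˡ-≤ q q≤p)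
  to : + 0 ℤ.≤ p ⊖ q → q ≤ p
  to 0≤ with q ≤? p
  ... | yes q≤p = q≤p
  ... | no  q≰p with q ∸ p | m>n⇒m∸n≢0 (≰⇒> q≰p) | subst (+ 0 ℤ.≤_) (ℤ.⊖-≰ q≰p) 0≤
  ...   | zero  | q∸p≢0 | _  = contradiction refl q∸p≢0
  ...   | suc _ | _     | ()

⊖≤+⇔ : ∀ {p q r} → p ⊖ q ℤ.≤ + r ⇔ p ≤ q + r
⊖≤+⇔ {p} {q} {r} = mk⇔ to from
  where
  [q+r]⊖q : ∀ r → (q + r) ⊖ q ≡ + r
  [q+r]⊖q r = trans (ℤ.⊖-≥ (m≤m+n q r)) (cong +_ (m+n∸m≡n q r))
  from : p ≤ q + r → p ⊖ q ℤ.≤ + r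
  from p≤ = subst (p ⊖ q ℤ.≤_) ([q+r]⊖q r) (ℤ.⊖-monoˡ-≤ q p≤)
  to : p ⊖ q ℤ.≤ + r → p ≤ q + r
  to ≤r = ≮⇒≥ λ q+r<p → <-irrefl refl (ℤ.drop‿+≤+ (ℤ.≤-trans
    (subst (ℤ._≤ p ⊖ q) (trans (cong (_⊖ q) (sym (+-suc q r))) ([q+r]⊖q (suc r))) (ℤ.⊖-monoˡ-≤ q q+r<p))
    ≤r))

∣⊖∣≡∣-∣ : ∀ p q → ℤ.∣ p ⊖ q ∣ ≡ ∣ p - q ∣
∣⊖∣≡∣-∣ p q with ≤-total p q
... | inj₁ p≤q = trans (ℤ.∣⊖∣-≤ p≤q) (sym (m≤n⇒∣m-n∣≡n∸m p≤q))
... | inj₂ q≤p = trans (ℤ.∣m⊖n∣≡∣n⊖m∣ p q)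
  (trans (ℤ.∣⊖∣-≤ q≤p) (sym (trans (∣-∣-comm p q) (m≤n⇒∣m-n∣≡n∸m q≤p))))

∣+p-+q∣ : ∀ p q → ℤ.∣ + p ℤ.- + q ∣ ≡ ∣ p - q ∣
∣+p-+q∣ p q = trans (cong ℤ.∣_∣ (ℤ.[+m]-[+n]≡m⊖n p q)) (∣⊖∣≡∣-∣ p q)

kingDist : ℤ × ℤ → ℤ × ℤ → ℕ
kingDist (x , y) (x′ , y′) = ℤ.∣ x ℤ.- x′ ∣ ⊔ ℤ.∣ y ℤ.- y′ ∣

module H1 (m : ℕ) where

  InH1 : ℤ × ℤ → Set
  InH1 u = (+ 0 ℤ.≤ s u) × (s u ℤ.≤ + (2 * m)) × (+ 0 ℤ.≤ t u) × (t u ℤ.≤ + (2 * m))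

  coords : Point → ℤ × ℤ
  coords (a , b) = + a , + m ℤ.- + b

  s-coords : ∀ a b → s (coords (a , b)) ≡ (a + m) ⊖ b
  s-coords a b = trans (regroup (+ a) (+ m) (+ b)) (ℤ.[+m]-[+n]≡m⊖n (a + m) b)
    where
    regroup : ∀ x y z → x ℤ.+ (y ℤ.- z) ≡ (x ℤ.+ y) ℤ.- z
    regroup = solve-∀

  t-coords : ∀ a b → t (coords (a , b)) ≡ (a + b) ⊖ m
  t-coords a b = trans (regroup (+ a) (+ m) (+ b)) (ℤ.[+m]-[+n]≡m⊖n (a + b) m)
    where
    regroup : ∀ x y z → x ℤ.- (y ℤ.- z) ≡ (x ℤ.+ z) ℤ.- y
    regroup = solve-∀

  InH1-coords⇔ : ∀ a b → InH1 (coords (a , b)) ⇔ Diamond m (a , b)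
  InH1-coords⇔ a b rewrite s-coords a b | t-coords a b =
    0≤⊖⇔ ×-⇔ ⇔.trans (⊖≤+⇔ {q = b}) a+m≤b+2m⇔ ×-⇔
    0≤⊖⇔ ×-⇔ ⇔.trans (⊖≤+⇔ {q = m}) a+b≤m+2m⇔
    where
    b+2m≡ : b + 2 * m ≡ b + m + m
    b+2m≡ = trans (cong (b ℕ.+_) (2*m≡m+m m)) (sym (+-assoc b m m))
    a+m≤b+2m⇔ : a + m ≤ b + 2 * m ⇔ a ≤ b + m
    a+m≤b+2m⇔ = mk⇔ (λ le → +-cancelʳ-≤ m a (b + m) (subst (a + m ≤_) b+2m≡ le))
                    (λ le → subst (a + m ≤_) (sym b+2m≡) (+-monoˡ-≤ m le))
    m+2m≡ : m + 2 * m ≡ m + m + m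
    m+2m≡ = trans (cong (m ℕ.+_) (2*m≡m+m m)) (sym (+-assoc m m m))
    a+b≤m+2m⇔ : a + b ≤ m + 2 * m ⇔ a + b ≤ m + m + m
    a+b≤m+2m⇔ = subst (λ z → (a + b ≤ m + 2 * m) ⇔ (a + b ≤ z)) m+2m≡ ⇔.refl

  pointOf : ℤ × ℤ → Point
  pointOf (x , y) = ℤ.∣ x ∣ , ℤ.∣ + m ℤ.- y ∣

  toPoint : H1V m → Point
  toPoint h = pointOf (proj₁ h)

  coords-toPoint : ∀ h → proj₁ h ≡ coords (toPoint h)
  coords-toPoint ((x , y) , 0≤s , s≤2m , 0≤t , _) = cong₂ _,_
    (sym (ℤ.0≤i⇒+∣i∣≡i 0≤x))
    (trans (sym (M-[M-y] (+ m) y)) (cong (ℤ._-_ (+ m)) (sym (ℤ.0≤i⇒+∣i∣≡i 0≤m-y))))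
    where
    0≤i+i⇒0≤i : ∀ {i} → + 0 ℤ.≤ i ℤ.+ i → + 0 ℤ.≤ i
    0≤i+i⇒0≤i {+ _}      _  = +≤+ z≤n
    0≤i+i⇒0≤i { -[1+ _ ]} ()
    x+y+[x-y] : ∀ x y → (x ℤ.+ y) ℤ.+ (x ℤ.- y) ≡ x ℤ.+ x
    x+y+[x-y] = solve-∀
    2M-[x+y]+[x-y] : ∀ M x y → ((M ℤ.+ M) ℤ.- (x ℤ.+ y)) ℤ.+ (x ℤ.- y) ≡ (M ℤ.- y) ℤ.+ (M ℤ.- y)
    2M-[x+y]+[x-y] = solve-∀
    M-[M-y] : ∀ M y → M ℤ.- (M ℤ.- y) ≡ y
    M-[M-y] = solve-∀
    0≤x : + 0 ℤ.≤ x
    0≤x = 0≤i+i⇒0≤i (subst (+ 0 ℤ.≤_) (x+y+[x-y] x y) (ℤ.+-mono-≤ 0≤s 0≤t))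
    0≤m-y : + 0 ℤ.≤ + m ℤ.- y
    0≤m-y = 0≤i+i⇒0≤i (subst (+ 0 ℤ.≤_) (2M-[x+y]+[x-y] (+ m) x y) (ℤ.+-mono-≤
      (subst (λ z → + 0 ℤ.≤ z ℤ.- (x ℤ.+ y)) (cong +_ (2*m≡m+m m)) (ℤ.i≤j⇒0≤j-i s≤2m)) 0≤t))

  Diamond-toPoint : ∀ h → Diamond m (toPoint h)
  Diamond-toPoint h = Equivalence.to (InH1-coords⇔ _ _) (subst InH1 (coords-toPoint h) (proj₂ h))

  fromPoint : ∀ p → Diamond m p → H1V m
  fromPoint (a , b) d = coords (a , b) , Equivalence.from (InH1-coords⇔ a b) d

  toPoint-fromPoint : ∀ p d → toPoint (fromPoint p d) ≡ p
  toPoint-fromPoint (a , b) d = cong (a ,_) (cong ℤ.∣_∣ (M-[M-B] (+ m) (+ b)))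
    where
    M-[M-B] : ∀ M B → M ℤ.- (M ℤ.- B) ≡ B
    M-[M-B] = solve-∀

  toPoint-injective : ∀ {h h′} → toPoint h ≡ toPoint h′ → proj₁ h ≡ proj₁ h′
  toPoint-injective {h} {h′} eq = trans (coords-toPoint h) (trans (cong coords eq) (sym (coords-toPoint h′)))

  H1V-≡ : ∀ {h h′ : H1V m} → proj₁ h ≡ proj₁ h′ → h ≡ h′
  H1V-≡ {u , a₁ , a₂ , a₃ , a₄} {.u , b₁ , b₂ , b₃ , b₄} refl
    rewrite ℤ.≤-irrelevant a₁ b₁ | ℤ.≤-irrelevant a₂ b₂
          | ℤ.≤-irrelevant a₃ b₃ | ℤ.≤-irrelevant a₄ b₄ = refl

  kingDist-coords : ∀ p q → kingDist (coords p) (coords q) ≡ chebyshev p q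
  kingDist-coords (a , b) (a′ , b′) = cong₂ _⊔_ (∣+p-+q∣ a a′)
    (trans (cong ℤ.∣_∣ ([M-B]-[M-B′] (+ m) (+ b) (+ b′))) (trans (∣+p-+q∣ b′ b) (∣-∣-comm b′ b)))
    where
    [M-B]-[M-B′] : ∀ M B B′ → (M ℤ.- B) ℤ.- (M ℤ.- B′) ≡ B′ ℤ.- B
    [M-B]-[M-B′] = solve-∀

  kingDist-toPoint : ∀ h h′ → kingDist (proj₁ h) (proj₁ h′) ≡ chebyshev (toPoint h) (toPoint h′)
  kingDist-toPoint h h′ =
    trans (cong₂ kingDist (coords-toPoint h) (coords-toPoint h′)) (kingDist-coords (toPoint h) (toPoint h′))

  H1Adj⇔ : ∀ h h′ → H1Adj m h h′ ⇔ chebyshev (toPoint h) (toPoint h′) ≡ 1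
  H1Adj⇔ h h′ = mk⇔
    (λ (_ , d≡1) → trans (sym (kingDist-toPoint h h′)) d≡1)
    (λ d≡1 → (λ u≡u′ → 0≢1+n (trans (sym (chebyshev-refl (toPoint h)))
                                    (trans (cong (chebyshev (toPoint h) ∘ pointOf) u≡u′) d≡1)))
           , trans (kingDist-toPoint h h′) d≡1)

  chebyshev≤len : ∀ {h h′} (w : Walk (H1Adj m) h h′) → chebyshev (toPoint h) (toPoint h′) ≤ len w
  chebyshev≤len {h} [] = ≤-reflexive (chebyshev-refl (toPoint h))
  chebyshev≤len {h} {h′} (_∷_ {w = h₁} e w) =
    ≤-trans (chebyshev-triangle (toPoint h) (toPoint h₁) (toPoint h′))
      (subst (λ d → d + _ ≤ suc (len w)) (sym (Equivalence.to (H1Adj⇔ h h₁) e)) (s≤s (chebyshev≤len w)))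

  walkOfLength : ∀ n h h′ → chebyshev (toPoint h) (toPoint h′) ≡ n →
    Σ (Walk (H1Adj m) h h′) λ w → len w ≡ n
  walkOfLength zero h h′ d≡0
    with refl ← H1V-≡ {h} {h′} (toPoint-injective {h} {h′} (chebyshev≡0⇒≡ d≡0)) = [] , refl
  walkOfLength (suc n) h h′ d≡1+n =
    map (Equivalence.from (H1Adj⇔ h h″) d≡1 ∷_) (cong suc) (walkOfLength n h″ h′ d″≡n)
    where
    p q : Point
    p = toPoint h
    q = toPoint h′
    d : Diamond m (stepTo p q)
    d = Diamond-stepTo (Diamond-toPoint h) (Diamond-toPoint h′)
    h″ : H1V m
    h″ = fromPoint (stepTo p q) d
    d≡1 : chebyshev p (toPoint h″) ≡ 1
    d≡1 = trans (cong (chebyshev p) (toPoint-fromPoint _ d))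
                (trans (chebyshev-stepTo-source p q) (cong (1 ⊓_) d≡1+n))
    d″≡n : chebyshev (toPoint h″) q ≡ n
    d″≡n = trans (cong (λ r → chebyshev r q) (toPoint-fromPoint _ d))
                 (trans (chebyshev-stepTo-target p q) (cong (_∸ 1) d≡1+n))

  H1-isDist : ∀ h h′ → IsDist (H1Adj m) h h′ (chebyshev (toPoint h) (toPoint h′))
  H1-isDist h h′ = walkOfLength _ h h′ refl , chebyshev≤len

-- The 4-cycle

C4Adj? : ∀ i j → Dec (C4Adj i j)
C4Adj? i j = (toℕ j ℕ.≟ suc (toℕ i) ℕ.% 4) ⊎-dec (toℕ i ℕ.≟ suc (toℕ j) ℕ.% 4)

c4-classification : ∀ i j → (i ≡ j × ¬ C4Adj i j × c4Dist i j ≡ 0)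
                          ⊎ (C4Adj i j × c4Dist i j ≡ 1)
                          ⊎ (i ≢ j × ¬ C4Adj i j × c4Dist i j ≡ 2)
c4-classification = toWitness {a? = Fin.all? λ i → Fin.all? λ j →
  (i Fin.≟ j ×-dec ¬? (C4Adj? i j) ×-dec c4Dist i j ℕ.≟ 0)
  ⊎-dec (C4Adj? i j ×-dec c4Dist i j ℕ.≟ 1)
  ⊎-dec (¬? (i Fin.≟ j) ×-dec ¬? (C4Adj? i j) ×-dec c4Dist i j ℕ.≟ 2)} _

C4-triangle-free : ∀ x y z → C4Adj x y → C4Adj y z → ¬ C4Adj x z
C4-triangle-free = toWitness {a? = Fin.all? λ x → Fin.all? λ y → Fin.all? λ z →
  C4Adj? x y →-dec C4Adj? y z →-dec ¬? (C4Adj? x z)} _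

C4-path-extends : ∀ a b → C4Adj a b → ∃ λ c → C4Adj b c × a ≢ c
C4-path-extends = toWitness {a? = Fin.all? λ a → Fin.all? λ b →
  C4Adj? a b →-dec Fin.any? λ c → C4Adj? b c ×-dec ¬? (a Fin.≟ c)} _

C4-common-neighbour : ∀ a c → a ≢ c → ¬ C4Adj a c → ∃ λ b → C4Adj a b × C4Adj b c
C4-common-neighbour = toWitness {a? = Fin.all? λ a → Fin.all? λ c →
  ¬? (a Fin.≟ c) →-dec ¬? (C4Adj? a c) →-dec Fin.any? λ b → C4Adj? a b ×-dec C4Adj? b c} _

injective⇒surjective : ∀ {n} (σ : Fin n → Fin n) → Injective _≡_ _≡_ σ → ∀ a → ∃ λ x → σ x ≡ a
injective⇒surjective {suc n} σ σ-injective a with Fin.any? (λ x → σ x Fin.≟ a)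
... | yes hit = hit
... | no miss = contradiction (Fin.injective⇒≤ punched-injective) 1+n≰n
  where
  a≢σ : ∀ x → a ≢ σ x
  a≢σ x a≡σx = miss (x , sym a≡σx)
  punched : Fin (suc n) → Fin n
  punched x = punchOut (a≢σ x)
  punched-injective : Injective _≡_ _≡_ punched
  punched-injective eq = σ-injective (Fin.punchOut-injective (a≢σ _) (a≢σ _) eq)

InducesC4-triangle-free : ∀ {V : Set} {E : V → V → Set} {w : Fin 4 → V} → InducesC4 E w →
  ∀ x y z → E (w x) (w y) → E (w y) (w z) → ¬ E (w x) (w z)
InducesC4-triangle-free (σ , σ-injective , E⇔C4) x y z xy yz xz
  with x′ , refl ← injective⇒surjective σ σ-injective x
     | y′ , refl ← injective⇒surjective σ σ-injective y
     | z′ , refl ← injective⇒surjective σ σ-injective z =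
  C4-triangle-free x′ y′ z′ (to (E⇔C4 x′ y′) xy) (to (E⇔C4 y′ z′) yz) (to (E⇔C4 x′ z′) xz)
  where open Equivalence

c4Dist-window⇔ : ∀ {m ℓ} → m ≤ ℓ → ℓ < 2 * m → ∀ i j →
  (0 < c4Dist i j * m × c4Dist i j * m ≤ ℓ) ⇔ C4Adj i j
c4Dist-window⇔ {zero} _ ()
c4Dist-window⇔ {suc k} {ℓ} m≤ℓ ℓ<2m i j with c4-classification i j
... | inj₁ (_ , ¬adj , c≡0) rewrite c≡0 = mk⇔ (λ ()) (λ adj → contradiction adj ¬adj)
... | inj₂ (inj₁ (adj , c≡1)) rewrite c≡1 =
  mk⇔ (λ _ → adj) (λ _ → s≤s z≤n , subst (_≤ ℓ) (sym (*-identityˡ (suc k))) m≤ℓ)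
... | inj₂ (inj₂ (_ , ¬adj , c≡2)) rewrite c≡2 =
  mk⇔ (λ (_ , 2m≤ℓ) → contradiction ℓ<2m (≤⇒≯ 2m≤ℓ)) (λ adj → contradiction adj ¬adj)

c4Dist*[1+m]≡0⇒≡ : ∀ {m} i j → c4Dist i j * suc m ≡ 0 → i ≡ j
c4Dist*[1+m]≡0⇒≡ i j c*m≡0 with c4-classification i j
... | inj₁ (i≡j , _) = i≡j
... | inj₂ (inj₁ (_ , c≡1)) rewrite c≡1 with () ← c*m≡0
... | inj₂ (inj₂ (_ , _ , c≡2)) rewrite c≡2 with () ← c*m≡0

-- Four vertices at the distances of the corners

IsometricCorners : (G : Graph) → ℕ → (Fin 4 → V G) → Set
IsometricCorners G m w = ∀ i j → Metric.dist G (w i) (w j) ≡ chebyshev (corner m i) (corner m j)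

IsometricCorners⇒HasC4InPowers : ∀ {G k} → ∃ (IsometricCorners G (suc k)) → HasC4InPowers G k
IsometricCorners⇒HasC4InPowers {G} {k} (w , w-isometric) = w , w-injective , λ ℓ k<ℓ ℓ≤1+2k →
  id , id , λ i j → ⇔.trans (PowAdj⇔ ℓ (w i) (w j))
    (subst (λ d → (0 < d × d ≤ ℓ) ⇔ C4Adj i j) (sym (dist-w i j))
      (c4Dist-window⇔ k<ℓ (≤-<-trans ℓ≤1+2k 1+2k<2[1+k]) i j))
  where
  open Metric G
  dist-w : ∀ i j → dist (w i) (w j) ≡ c4Dist i j * suc k
  dist-w i j = trans (w-isometric i j) (chebyshev-corner (suc k) i j)
  w-injective : ∀ {i j} → w i ≡ w j → i ≡ j
  w-injective {i} {j} wi≡wj = c4Dist*[1+m]≡0⇒≡ i j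
    (trans (sym (dist-w i j)) (trans (cong (dist (w i)) (sym wi≡wj)) (dist-refl (w i))))
  1+2k<2[1+k] : suc (2 * k) < 2 * suc k
  1+2k<2[1+k] = ≤-reflexive (sym (*-suc 2 k))

HasIsometricH1⇒IsometricCorners : ∀ {G m} → HasIsometricH1 G m → ∃ (IsometricCorners G m)
HasIsometricH1⇒IsometricCorners {G} {m} (f , _ , _ , f-isometric) = f ∘ cornerH1 , λ i j → begin
  dist (f (cornerH1 i)) (f (cornerH1 j))
    ≡⟨ Dist⇒≡dist (f-isometric _ _ _ (H1-isDist (cornerH1 i) (cornerH1 j))) ⟨
  chebyshev (toPoint (cornerH1 i)) (toPoint (cornerH1 j))
    ≡⟨ cong₂ chebyshev (toPoint-fromPoint _ (Diamond-corner m i)) (toPoint-fromPoint _ (Diamond-corner m j)) ⟩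
  chebyshev (corner m i) (corner m j) ∎
  where
  open Metric G
  open H1 m
  open ≡-Reasoning
  cornerH1 : Fin 4 → H1V m
  cornerH1 i = fromPoint (corner m i) (Diamond-corner m i)

module FromC4InPowers (G : Graph) {m ℓ : ℕ} (m≤ℓ : m ≤ ℓ) (2m≤1+ℓ : 2 * m ≤ suc ℓ)
  {w : Fin 4 → V G} (w-injective : Injective _≡_ _≡_ w)
  (c4ₘ : InducesC4 (PowAdj G m) w) (c4ℓ : InducesC4 (PowAdj G ℓ) w) where

  open Metric G

  σ : Fin 4 → Fin 4
  σ = proj₁ c4ₘ

  W : Fin 4 → V G
  W = w ∘ σ

  adjacent-near : ∀ {i j} → C4Adj i j → 0 < dist (W i) (W j) × dist (W i) (W j) ≤ m
  adjacent-near {i} {j} adj =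
    Equivalence.to (PowAdj⇔ m (W i) (W j)) (Equivalence.from (proj₂ (proj₂ c4ₘ) i j) adj)

  adjacent-powAdj : ∀ {i j} → C4Adj i j → PowAdj G ℓ (W i) (W j)
  adjacent-powAdj {i} {j} adj with 0<d , d≤m ← adjacent-near adj =
    Equivalence.from (PowAdj⇔ ℓ (W i) (W j)) (0<d , ≤-trans d≤m m≤ℓ)

  -- The lower bound: G^ℓ is triangle-free on w, so opposite corners are not ℓ-close.
  opposite-far : ∀ {a b c} → C4Adj a b → C4Adj b c → a ≢ c → dist (W a) (W c) ≡ 2 * m
  opposite-far {a} {b} {c} ab bc a≢c = ≤-antisym upper (≤-trans 2m≤1+ℓ (≰⇒> ¬≤ℓ))
    where
    upper : dist (W a) (W c) ≤ 2 * m
    upper = begin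
      dist (W a) (W c)                    ≤⟨ dist-triangle (W a) (W b) (W c) ⟩
      dist (W a) (W b) + dist (W b) (W c) ≤⟨ +-mono-≤ (proj₂ (adjacent-near ab)) (proj₂ (adjacent-near bc)) ⟩
      m + m                               ≡⟨ 2*m≡m+m m ⟨
      2 * m                               ∎
      where open ≤-Reasoning
    Wa≢Wc : W a ≢ W c
    Wa≢Wc Wa≡Wc = a≢c (proj₁ (proj₂ c4ₘ) (w-injective Wa≡Wc))
    ¬≤ℓ : ¬ dist (W a) (W c) ≤ ℓ
    ¬≤ℓ d≤ℓ = InducesC4-triangle-free {E = PowAdj G ℓ} {w} c4ℓ (σ a) (σ b) (σ c)
      (adjacent-powAdj ab) (adjacent-powAdj bc)
      (Equivalence.from (PowAdj⇔ ℓ (W a) (W c)) (n≢0⇒n>0 (Wa≢Wc ∘ dist≡0⇒≡) , d≤ℓ))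

  adjacent-exact : ∀ {a b} → C4Adj a b → dist (W a) (W b) ≡ m
  adjacent-exact {a} {b} ab with c , bc , a≢c ← C4-path-extends a b ab =
    ≤-antisym (proj₂ (adjacent-near ab)) (+-cancelʳ-≤ m m (dist (W a) (W b)) (begin
      m + m                               ≡⟨ 2*m≡m+m m ⟨
      2 * m                               ≡⟨ opposite-far ab bc a≢c ⟨
      dist (W a) (W c)                    ≤⟨ dist-triangle (W a) (W b) (W c) ⟩
      dist (W a) (W b) + dist (W b) (W c) ≤⟨ +-monoʳ-≤ (dist (W a) (W b)) (proj₂ (adjacent-near bc)) ⟩
      dist (W a) (W b) + m                ∎))
    where open ≤-Reasoning

  dist-W : ∀ i j → dist (W i) (W j) ≡ c4Dist i j * m
  dist-W i j with c4-classification i j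
  ... | inj₁ (refl , _ , c≡0) rewrite c≡0 = dist-refl (W i)
  ... | inj₂ (inj₁ (adj , c≡1)) rewrite c≡1 = trans (adjacent-exact adj) (sym (*-identityˡ m))
  ... | inj₂ (inj₂ (i≢j , ¬adj , c≡2)) rewrite c≡2
    with b , ib , bj ← C4-common-neighbour i j i≢j ¬adj = opposite-far ib bj i≢j

  W-isometric : IsometricCorners G m W
  W-isometric i j = trans (dist-W i j) (sym (chebyshev-corner m i j))

HasC4InPowers⇒IsometricCorners : ∀ {G k} → HasC4InPowers G k → ∃ (IsometricCorners G (suc k))
HasC4InPowers⇒IsometricCorners {G} {k} (w , w-injective , c4) = W , W-isometric
  where
  k+1≤2k+1 : suc k ≤ suc (2 * k)
  k+1≤2k+1 = s≤s (m≤m+n k _)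
  open FromC4InPowers G k+1≤2k+1 (≤-reflexive (*-suc 2 k)) w-injective
    (c4 (suc k) ≤-refl k+1≤2k+1) (c4 (suc (2 * k)) k+1≤2k+1 ≤-refl)

-- Extending the corners to an isometric diamond in a Helly graph

module _ {G : Graph} {m : ℕ} where
  open Metric G
  open H1 m

  embedding⇒HasIsometricH1 : (g : ∀ p → Diamond m p → V G) →
    (∀ {p q} d d′ → dist (g p d) (g q d′) ≡ chebyshev p q) → HasIsometricH1 G m
  embedding⇒HasIsometricH1 g g-isometric = f , f-injective , f-adj , f-dist
    where
    f : H1V m → V G
    f h = g (toPoint h) (Diamond-toPoint h)
    dist-f : ∀ a b → dist (f a) (f b) ≡ chebyshev (toPoint a) (toPoint b)
    dist-f a b = g-isometric (Diamond-toPoint a) (Diamond-toPoint b)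
    f-injective : ∀ a b → f a ≡ f b → proj₁ a ≡ proj₁ b
    f-injective a b fa≡fb = toPoint-injective {a} {b} (chebyshev≡0⇒≡
      (trans (sym (dist-f a b)) (trans (cong (dist (f a)) (sym fa≡fb)) (dist-refl (f a)))))
    f-adj : ∀ a b → H1Adj m a b ⇔ Adj G (f a) (f b)
    f-adj a b = mk⇔ (λ adj → dist≡1⇒Adj (trans (dist-f a b) (Equivalence.to (H1Adj⇔ a b) adj)))
                    (λ adj → Equivalence.from (H1Adj⇔ a b) (trans (sym (dist-f a b)) (Adj⇒dist≡1 adj)))
    f-dist : ∀ a b r → IsDist (H1Adj m) a b r → Dist G (f a) (f b) r
    f-dist a b r D = subst (Dist G (f a) (f b))
      (trans (dist-f a b) (IsDist-unique (H1-isDist a b) D)) (dist-isDist (f a) (f b))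

module HellyExtension {G : Graph} (helly : Helly G) {m : ℕ} {W : Fin 4 → V G}
  (W-isometric : IsometricCorners G m W) where

  open Metric G

  Entry : Set
  Entry = Point × V G

  cornerEntry : Fin 4 → Entry
  cornerEntry i = corner m i , W i

  record IsTable (S : List Entry) : Set where
    field
      in-diamond : ∀ {e} → e ∈ S → Diamond m (proj₁ e)
      isometric  : ∀ {e e′} → e ∈ S → e′ ∈ S → dist (proj₂ e) (proj₂ e′) ≡ chebyshev (proj₁ e) (proj₁ e′)
      corners    : ∀ i → cornerEntry i ∈ S

  cornerTable : IsTable (tabulate cornerEntry)
  cornerTable = record
    { in-diamond = λ e∈ → let i , e≡ = ∈-tabulate⁻ {f = cornerEntry} e∈ in
        subst (Diamond m ∘ proj₁) (sym e≡) (Diamond-corner m i)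
    ; isometric  = λ e∈ e′∈ →
        let i , e≡ = ∈-tabulate⁻ {f = cornerEntry} e∈; j , e′≡ = ∈-tabulate⁻ {f = cornerEntry} e′∈ in
        subst₂ (λ e e′ → dist (proj₂ e) (proj₂ e′) ≡ chebyshev (proj₁ e) (proj₁ e′)) (sym e≡) (sym e′≡)
          (W-isometric i j)
    ; corners    = ∈-tabulate⁺
    }

  module _ {S : List Entry} (T : IsTable S) {p : Point} (p-diamond : Diamond m p) where
    open IsTable T

    helly-center : ∃ λ x → ∀ {e} → e ∈ S → dist x (proj₂ e) ≤ chebyshev p (proj₁ e)
    helly-center = x , λ e∈ → subst (λ e → dist x (proj₂ e) ≤ chebyshev p (proj₁ e))
      (sym (lookup-index e∈)) (Equivalence.to InDisk⇔ (x∈disks (index e∈)))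
      where
      q : Fin (length S) → Point
      q i = proj₁ (lookup S i)
      c : Fin (length S) → V G
      c i = proj₂ (lookup S i)
      r : Fin (length S) → ℕ
      r i = chebyshev p (q i)
      pairwise : ∀ i j → ∃ λ u → InDisk G u (c i) (r i) × InDisk G u (c j) (r j)
      pairwise i j = disks-intersect (c i) (c j) (r i) (r j) (begin
        dist (c i) (c j)        ≡⟨ isometric (∈-lookup i) (∈-lookup j) ⟩
        chebyshev (q i) (q j)   ≤⟨ chebyshev-triangle (q i) p (q j) ⟩
        chebyshev (q i) p + r j ≡⟨ cong (_+ r j) (chebyshev-sym (q i) p) ⟩
        r i + r j               ∎)
        where open ≤-Reasoning
      x : V G
      x = proj₁ (helly (length S) c r pairwise)
      x∈disks : ∀ i → InDisk G x (c i) (r i)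
      x∈disks = proj₂ (helly (length S) c r pairwise)

    center : V G
    center = proj₁ helly-center

    center-at-corner : ∀ i j →
      chebyshev p (corner m i) + chebyshev p (corner m j) ≡ chebyshev (corner m i) (corner m j) →
      dist center (W i) ≡ chebyshev p (corner m i)
    center-at-corner i j between = dist-squeeze (trans (W-isometric i j) (sym between))
      (proj₂ helly-center (corners i)) (proj₂ helly-center (corners j))

    center-exact : ∀ {e} → e ∈ S → dist center (proj₂ e) ≡ chebyshev p (proj₁ e)
    center-exact {q , v} e∈ = ≤-antisym (proj₂ helly-center e∈) (begin
      chebyshev p q
        ≡⟨ chebyshev-via-corners p-diamond (in-diamond e∈) ⟩
      ∣ chebyshev p c₀ - chebyshev q c₀ ∣ ⊔ ∣ chebyshev p c₁ - chebyshev q c₁ ∣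
        ≡⟨ cong₂ _⊔_ (cong₂ ∣_-_∣ x₀ (isometric e∈ (corners zero)))
                     (cong₂ ∣_-_∣ x₁ (isometric e∈ (corners (suc zero)))) ⟨
      ∣ dist center (W zero) - dist v (W zero) ∣ ⊔ ∣ dist center (W (suc zero)) - dist v (W (suc zero)) ∣
        ≤⟨ ⊔-lub (dist-reverse-triangle center v (W zero)) (dist-reverse-triangle center v (W (suc zero))) ⟩
      dist center v ∎)
      where
      open ≤-Reasoning
      c₀ c₁ : Point
      c₀ = corner m zero
      c₁ = corner m (suc zero)
      x₀ : dist center (W zero) ≡ chebyshev p c₀
      x₀ = center-at-corner zero (suc (suc zero)) (between-corners₀₂ p-diamond)
      x₁ : dist center (W (suc zero)) ≡ chebyshev p c₁
      x₁ = center-at-corner (suc zero) (suc (suc (suc zero))) (between-corners₁₃ p-diamond)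

  extend : ∀ {S} → IsTable S → ∀ {p} → Diamond m p → ∃ λ x → IsTable ((p , x) ∷ S)
  extend {S} T {p} p-diamond = center T p-diamond , record
    { in-diamond = λ { (here refl) → p-diamond ; (there e∈) → in-diamond e∈ }
    ; isometric  = λ
      { (here refl) (here refl) → trans (dist-refl _) (sym (chebyshev-refl p))
      ; (here refl) (there e′∈) → center-exact T p-diamond e′∈
      ; (there e∈)  (here refl) → trans (dist-sym _ _) (trans (center-exact T p-diamond e∈) (chebyshev-sym p _))
      ; (there e∈)  (there e′∈) → isometric e∈ e′∈
      }
    ; corners    = there ∘ corners
    }
    where open IsTable T

  covering-table : ∀ (L : List Point) →
    ∃ λ S → IsTable S × (∀ {p} → p ∈ L → Diamond m p → ∃ λ v → (p , v) ∈ S)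
  covering-table [] = _ , cornerTable , λ ()
  covering-table (p ∷ L) with S , T , covers ← covering-table L | diamond? m p
  ... | no ¬d = S , T , λ { (here refl) d → contradiction d ¬d ; (there q∈) d → covers q∈ d }
  ... | yes d with x , T′ ← extend T d =
    _ , T′ , λ { (here refl) _ → x , here refl ; (there q∈) d′ → map id there (covers q∈ d′) }

  candidates : List Point
  candidates = cartesianProduct (upTo (suc (m + m))) (upTo (suc (m + m)))

  diamond⊆candidates : ∀ {p} → Diamond m p → p ∈ candidates
  diamond⊆candidates {a , b} d = ∈-cartesianProduct⁺
    (∈-upTo⁺ (s≤s (Diamond-bound d))) (∈-upTo⁺ (s≤s (Diamond-bound (Diamond-swap {m} {a , b} d))))

  private
    table : List Entry
    table = proj₁ (covering-table candidates)

    table-isTable : IsTable table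
    table-isTable = proj₁ (proj₂ (covering-table candidates))

    table-covers : ∀ {p} → Diamond m p → ∃ λ v → (p , v) ∈ table
    table-covers d = proj₂ (proj₂ (covering-table candidates)) (diamond⊆candidates d) d

  embedding : ∀ p → Diamond m p → V G
  embedding p d = proj₁ (table-covers d)

  embedding-isometric : ∀ {p q} d d′ → dist (embedding p d) (embedding q d′) ≡ chebyshev p q
  embedding-isometric d d′ = IsTable.isometric table-isTable (proj₂ (table-covers d)) (proj₂ (table-covers d′))

IsometricCorners⇒HasIsometricH1 : ∀ {G m} → Helly G → ∃ (IsometricCorners G m) → HasIsometricH1 G m
IsometricCorners⇒HasIsometricH1 helly (_ , W-isometric) = embedding⇒HasIsometricH1 embedding embedding-isometric
  where open HellyExtension helly W-isometric

lemma10 : (G : Graph) → Helly G → (k : ℕ) →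
    HasIsometricH1 G (suc k) ⇔ HasC4InPowers G k
lemma10 G helly k = mk⇔
  (IsometricCorners⇒HasC4InPowers ∘ HasIsometricH1⇒IsometricCorners {G})
  (IsometricCorners⇒HasIsometricH1 helly ∘ HasC4InPowers⇒IsometricCorners {G})
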